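{- Let $m\geq 1$ and let $L=\{1^{a_1},2^{a_2},\ldots,m^{a_m}\}$ with $a_1\geq a_2\geq\cdots\geq a_m>0$. Then $L$ has a standard linear realization.
   Context: The notation $\{1^{a_1},\ldots,m^{a_m}\}$ denotes the multiset with $a_i$ copies of $i$. For a list (multiset) $L$ of positive integers with $|L|$ elements, a linear realization of $L$ is an ordering $[x_0,\ldots,x_{|L|}]$ of $\{0,1,\ldots,|L|\}$ such that the multiset $\{|x_i-x_{i+1}|:0\le i\le |L|-1\}$ equals $L$; it is standard if $x_0=0$. -}

module Defs where

open import Data.Nat using (ℕ; zero; suc; _+_; ∣_-_∣)
open import Data.Fin using (Fin; toℕ)
open import Data.List using (List; []; _∷_; length; upTo; replicate; concatMap; head; allFin)
open import Data.List.Relation.Binary.Permutation.Propositional using (_↭_)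
open import Data.Product using (_×_)
open import Data.Maybe using (just)
open import Relation.Binary.PropositionalEquality using (_≡_)

-- The multiset {1^{a_1}, ..., m^{a_m}} as a list: a (i) copies of (toℕ i + 1),
-- for i = 0, ..., m-1 (Fin m indexes 1..m shifted by one).
multisetList : (m : ℕ) → (Fin m → ℕ) → List ℕ
multisetList m a = concatMap (λ i → replicate (a i) (suc (toℕ i))) (allFin m)

diffs : List ℕ → List ℕ
diffs []           = []
diffs (x ∷ [])     = []
diffs (x ∷ y ∷ xs) = ∣ x - y ∣ ∷ diffs (y ∷ xs)

LinearRealization : List ℕ → List ℕ → Set
LinearRealization L xs = (xs ↭ upTo (suc (length L))) × (diffs xs ↭ L)

StandardLinearRealization : List ℕ → List ℕ → Set
StandardLinearRealization L xs = LinearRealization L xs × (head xs ≡ just 0)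

-- A perfect path of order n is a walk through all of 0, ..., n-1 whose steps
-- are exactly 1, ..., n-1.  The key fact (perfectFrom) is that every vertex
-- starts a perfect path.  For a vertex s of the lower half this is proved by
-- strong induction on h = ⌊n/2⌋, with the path ending at s + h, using three
-- ways of building larger perfect paths from smaller ones: the mirror
-- construction, the odd zigzag, and an even zigzag conjugated by the
-- reflection x ↦ n-1-x; the same reflection handles the upper half.
--
-- L consists of aₘ blocks {1, ..., m} together with the multiset for the
-- antitone multiplicities aᵢ - aₘ (i < m).  A standard realization whose last
-- vertex lies at most k below its top extends to one with an extra block
-- {1, ..., k+1}: jump by k+1 onto a translated perfect path of order k+1
-- starting at a suitable vertex.  Adding blocks in increasing size order
-- gives the theorem by induction on m.
module Submission where

open import Defs
open import Data.Nat using (ℕ; suc; _≤_; _<_)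
open import Data.Fin using (Fin) renaming (_≤_ to _≤ᶠ_)
open import Data.List using (List)
open import Data.Product using (Σ)

open import Data.Nat
open import Data.Nat.Properties
open import Data.Nat.Induction using (<-rec)
open import Data.Nat.Tactic.RingSolver using (solve-∀)
open import Data.Fin using (toℕ; inject₁; fromℕ)
import Data.Fin as Fin
import Data.Fin.Properties as Fin
open import Data.List using ([]; _∷_; _++_; _∷ʳ_; map; [_]; replicate; concat; tabulate; allFin; length; upTo; applyUpTo)
import Data.List.Properties as List
open import Data.List.Relation.Binary.Permutation.Propositional
  using (_↭_; ↭-refl; ↭-sym; ↭-trans; ↭-reflexive; ↭-prep; ↭-swap; module PermutationReasoning)
import Data.List.Relation.Binary.Permutation.Propositional.Properties as ↭
open import Data.List.Relation.Unary.All as All using (All; []; _∷_)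
open import Data.Product using (_×_; _,_; proj₁; proj₂; Σ-syntax)
open import Data.Sum using (_⊎_; inj₁; inj₂)
open import Function using (_∘_)
open import Induction.WellFounded using (WfRec)
open import Relation.Binary.Definitions using (tri<; tri≈; tri>)
open import Relation.Binary.PropositionalEquality hiding ([_])
open import Relation.Nullary using (yes; no)

interval : ℕ → ℕ → List ℕ
interval a zero    = []
interval a (suc k) = a ∷ interval (suc a) k

descending : ℕ → ℕ → List ℕ
descending a zero    = []
descending a (suc k) = (a + k) ∷ descending a k

steps : ℕ → List ℕ → List ℕ
steps x []       = []
steps x (y ∷ ys) = ∣ x - y ∣ ∷ steps y ys

final : ℕ → List ℕ → ℕ
final x []       = x
final x (y ∷ ys) = final y ys

diffs≡steps : ∀ x xs → diffs (x ∷ xs) ≡ steps x xs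
diffs≡steps x []       = refl
diffs≡steps x (y ∷ ys) = cong (∣ x - y ∣ ∷_) (diffs≡steps y ys)

steps-++ : ∀ x xs ys → steps x (xs ++ ys) ≡ steps x xs ++ steps (final x xs) ys
steps-++ x []       ys = refl
steps-++ x (y ∷ xs) ys = cong (∣ x - y ∣ ∷_) (steps-++ y xs ys)

final-++ : ∀ x xs ys → final x (xs ++ ys) ≡ final (final x xs) ys
final-++ x []       ys = refl
final-++ x (y ∷ xs) ys = final-++ y xs ys

interval-++ : ∀ a k l → interval a (k + l) ≡ interval a k ++ interval (a + k) l
interval-++ a zero    l = cong (λ b → interval b l) (sym (+-identityʳ a))
interval-++ a (suc k) l = cong (a ∷_) (begin
  interval (suc a) (k + l)                  ≡⟨ interval-++ (suc a) k l ⟩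
  interval (suc a) k ++ interval (suc a + k) l ≡⟨ cong (λ b → interval (suc a) k ++ interval b l) (sym (+-suc a k)) ⟩
  interval (suc a) k ++ interval (a + suc k) l ∎)
  where open ≡-Reasoning

interval-∷ʳ : ∀ a k → interval a (suc k) ≡ interval a k ++ [ a + k ]
interval-∷ʳ a k = trans (cong (interval a) (+-comm 1 k)) (interval-++ a k 1)

interval-++₃ : ∀ a b c → interval 0 (a + b + c) ≡ interval 0 a ++ interval a b ++ interval (a + b) c
interval-++₃ a b c = begin
  interval 0 (a + b + c)                             ≡⟨ interval-++ 0 (a + b) c ⟩
  interval 0 (a + b) ++ interval (a + b) c            ≡⟨ cong (_++ interval (a + b) c) (interval-++ 0 a b) ⟩
  (interval 0 a ++ interval a b) ++ interval (a + b) c ≡⟨ List.++-assoc (interval 0 a) (interval a b) _ ⟩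
  interval 0 a ++ interval a b ++ interval (a + b) c  ∎
  where open ≡-Reasoning

map-+-interval : ∀ c a k → map (c +_) (interval a k) ≡ interval (c + a) k
map-+-interval c a zero    = refl
map-+-interval c a (suc k) =
  cong (c + a ∷_) (trans (map-+-interval c (suc a) k) (cong (λ b → interval b k) (+-suc c a)))

upTo≡interval : ∀ n → upTo n ≡ interval 0 n
upTo≡interval zero    = refl
upTo≡interval (suc n) = cong (0 ∷_) (begin
  applyUpTo suc n          ≡⟨ sym (List.map-upTo suc n) ⟩
  map suc (upTo n)         ≡⟨ cong (map suc) (upTo≡interval n) ⟩
  map (1 +_) (interval 0 n) ≡⟨ map-+-interval 1 0 n ⟩
  interval 1 n             ∎)
  where open ≡-Reasoning

length-interval : ∀ a k → length (interval a k) ≡ k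
length-interval a zero    = refl
length-interval a (suc k) = cong suc (length-interval (suc a) k)

length-steps : ∀ x xs → length (steps x xs) ≡ length xs
length-steps x []       = refl
length-steps x (y ∷ ys) = cong suc (length-steps y ys)

descending↭interval : ∀ a k → descending a k ↭ interval a k
descending↭interval a zero    = ↭-refl
descending↭interval a (suc k) = begin
  (a + k) ∷ descending a k      ↭⟨ ↭-prep _ (descending↭interval a k) ⟩
  (a + k) ∷ interval a k        ↭⟨ ↭.∷↭∷ʳ (a + k) (interval a k) ⟩
  interval a k ++ [ a + k ]     ≡⟨ sym (interval-∷ʳ a k) ⟩
  interval a (suc k)            ∎
  where open PermutationReasoning

interval-bounded : ∀ a k → All (_< a + k) (interval a k)
interval-bounded a zero    = []
interval-bounded a (suc k) =
  subst (_< a + suc k) (+-identityʳ a) (+-monoʳ-< a (s≤s z≤n))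
  ∷ subst (λ b → All (_< b) (interval (suc a) k)) (sym (+-suc a k)) (interval-bounded (suc a) k)

∣m+n-m∣≡n : ∀ m n → ∣ m + n - m ∣ ≡ n
∣m+n-m∣≡n m n = trans (∣-∣-comm (m + n) m) (∣m-m+n∣≡n m n)

steps-translate : ∀ c x xs → steps (c + x) (map (c +_) xs) ≡ steps x xs
steps-translate c x []       = refl
steps-translate c x (y ∷ ys) = cong₂ _∷_ (∣m+n-m+o∣≡∣n-o∣ c x y) (steps-translate c y ys)

final-translate : ∀ c x xs → final (c + x) (map (c +_) xs) ≡ c + final x xs
final-translate c x []       = refl
final-translate c x (y ∷ ys) = final-translate c y ys

∣∸-∸∣ : ∀ c x y → x ≤ c → y ≤ c → ∣ (c ∸ x) - (c ∸ y) ∣ ≡ ∣ x - y ∣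
∣∸-∸∣ c       zero    zero    _ _ = ∣n-n∣≡0 c
∣∸-∸∣ c       zero    (suc y) _ y≤c = trans (m≤n⇒∣n-m∣≡n∸m (m∸n≤m c (suc y))) (m∸[m∸n]≡n y≤c)
∣∸-∸∣ c       (suc x) zero    x≤c _ = trans (m≤n⇒∣m-n∣≡n∸m (m∸n≤m c (suc x))) (m∸[m∸n]≡n x≤c)
∣∸-∸∣ (suc c) (suc x) (suc y) (s≤s x≤c) (s≤s y≤c) = ∣∸-∸∣ c x y x≤c y≤c

steps-reflect : ∀ c x xs → x ≤ c → All (_≤ c) xs → steps (c ∸ x) (map (c ∸_) xs) ≡ steps x xs
steps-reflect c x []       _   _             = refl
steps-reflect c x (y ∷ ys) x≤c (y≤c ∷ ys≤c) = cong₂ _∷_ (∣∸-∸∣ c x y x≤c y≤c) (steps-reflect c y ys y≤c ys≤c)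

final-reflect : ∀ c x xs → final (c ∸ x) (map (c ∸_) xs) ≡ c ∸ final x xs
final-reflect c x []       = refl
final-reflect c x (y ∷ ys) = final-reflect c y ys

reflect-interval : ∀ c → map (c ∸_) (interval 0 (suc c)) ↭ interval 0 (suc c)
reflect-interval zero    = ↭-refl
reflect-interval (suc c) = begin
  suc c ∷ map (suc c ∸_) (interval 1 (suc c))        ≡⟨ cong (λ l → suc c ∷ map (suc c ∸_) l) (sym (map-+-interval 1 0 (suc c))) ⟩
  suc c ∷ map (suc c ∸_) (map suc (interval 0 (suc c))) ≡⟨ cong (suc c ∷_) (sym (List.map-∘ (interval 0 (suc c)))) ⟩
  suc c ∷ map (c ∸_) (interval 0 (suc c))            ↭⟨ ↭-prep (suc c) (reflect-interval c) ⟩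
  suc c ∷ interval 0 (suc c)                         ↭⟨ ↭.∷↭∷ʳ (suc c) (interval 0 (suc c)) ⟩
  interval 0 (suc c) ++ [ suc c ]                    ≡⟨ sym (interval-∷ʳ 0 (suc c)) ⟩
  interval 0 (suc (suc c))                           ∎
  where open PermutationReasoning

record PerfectPath (n s e : ℕ) : Set where
  constructor perfect
  field
    rest     : List ℕ
    vertices : (s ∷ rest) ↭ interval 0 n
    lengths  : steps s rest ↭ interval 1 (pred n)
    ends     : final s rest ≡ e

trivialPath : PerfectPath 1 0 0
trivialPath = perfect [] ↭-refl ↭-refl refl

castPath : ∀ {n n′ s s′ e e′} → n ≡ n′ → s ≡ s′ → e ≡ e′ → PerfectPath n s e → PerfectPath n′ s′ e′
castPath refl refl refl p = p

final<order : ∀ {n s e} → PerfectPath n s e → e < n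
final<order {n} (perfect r vs _ refl) = final-bounded _ r (↭.All-resp-↭ (↭-sym vs) (interval-bounded 0 n))
  where
  final-bounded : ∀ x xs → All (_< n) (x ∷ xs) → final x xs < n
  final-bounded x []       (x<n ∷ _)   = x<n
  final-bounded x (y ∷ ys) (_   ∷ ys<n) = final-bounded y ys ys<n

translate-vertices : ∀ c {n s e} (p : PerfectPath n s e) → map (c +_) (s ∷ PerfectPath.rest p) ↭ interval c n
translate-vertices c {n} {s} p =
  subst (map (c +_) (s ∷ PerfectPath.rest p) ↭_) (trans (map-+-interval c 0 n) (cong (λ a → interval a n) (+-identityʳ c)))
        (↭.map⁺ (c +_) (PerfectPath.vertices p))

lengths-++ : ∀ K m {D X} → D ↭ interval 1 K → X ↭ interval (suc (suc K)) m →
             D ++ (suc K ∷ X) ↭ interval 1 (K + suc m)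
lengths-++ K m {D} {X} D↭ X↭ = begin
  D ++ (suc K ∷ X)                           ↭⟨ ↭.++⁺ D↭ (↭-prep (suc K) X↭) ⟩
  interval 1 K ++ interval (suc K) (suc m)   ≡⟨ sym (interval-++ 1 K (suc m)) ⟩
  interval 1 (K + suc m)                     ∎
  where open PermutationReasoning

reflect : ∀ {c s e} s′ e′ → PerfectPath (suc c) s e → s + s′ ≡ c → e + e′ ≡ c →
          PerfectPath (suc c) s′ e′
reflect {c} {s} {e} s′ e′ (perfect r vs ls refl) s+s′≡c e+e′≡c =
  castPath refl s′≡ e′≡ (perfect (map (c ∸_) r) vertices′ lengths′ (final-reflect c s r))
  where
  bounded : All (_≤ c) (s ∷ r)
  bounded = ↭.All-resp-↭ (↭-sym vs) (All.map ≤-pred (interval-bounded 0 (suc c)))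
  s′≡ : c ∸ s ≡ s′
  s′≡ = trans (cong (_∸ s) (sym s+s′≡c)) (m+n∸m≡n s s′)
  e′≡ : c ∸ e ≡ e′
  e′≡ = trans (cong (_∸ e) (sym e+e′≡c)) (m+n∸m≡n e e′)
  vertices′ : map (c ∸_) (s ∷ r) ↭ interval 0 (suc c)
  vertices′ = ↭-trans (↭.map⁺ (c ∸_) vs) (reflect-interval c)
  lengths′ : steps (c ∸ s) (map (c ∸_) r) ↭ interval 1 c
  lengths′ with bounded
  ... | s≤c ∷ r≤c = subst (_↭ interval 1 c) (sym (steps-reflect c s r s≤c r≤c)) ls

spread : ℕ → ℕ → List ℕ
spread b zero    = []
spread b (suc k) = k ∷ b ∷ spread (suc b) k

spread-vertices : ∀ b k → spread b k ↭ interval 0 k ++ interval b k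
spread-vertices b zero    = ↭-refl
spread-vertices b (suc k) = begin
  k ∷ b ∷ spread (suc b) k                            ↭⟨ ↭-prep k (↭-prep b (spread-vertices (suc b) k)) ⟩
  k ∷ b ∷ (interval 0 k ++ interval (suc b) k)        ↭⟨ ↭-prep k (↭-sym (↭.shift b (interval 0 k) _)) ⟩
  k ∷ (interval 0 k ++ interval b (suc k))            ↭⟨ ↭-sym (↭.shift k (interval 0 k) _) ⟩
  interval 0 k ++ [ k ] ++ interval b (suc k)         ≡⟨ sym (List.++-assoc (interval 0 k) [ k ] _) ⟩
  (interval 0 k ++ [ k ]) ++ interval b (suc k)       ≡⟨ cong (_++ interval b (suc k)) (sym (interval-∷ʳ 0 k)) ⟩
  interval 0 (suc k) ++ interval b (suc k)            ∎
  where open PermutationReasoning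

spread-steps : ∀ k D → steps k (k + suc D ∷ spread (suc (k + suc D)) k) ≡ interval (suc D) (suc (k + k))
spread-steps zero    D = refl
spread-steps (suc k) D = cong₂ _∷_ (∣m-m+n∣≡n (suc k) (suc D)) (cong₂ _∷_ downStep (begin
  steps k (suc (suc k + suc D) ∷ spread (suc (suc (suc k + suc D))) k)
    ≡⟨ cong (λ b → steps k (b ∷ spread (suc b) k)) (sym (trans (+-suc k _) (cong suc (+-suc k (suc D))))) ⟩
  steps k (k + suc (suc (suc D)) ∷ spread (suc (k + suc (suc (suc D)))) k)
    ≡⟨ spread-steps k (suc (suc D)) ⟩
  interval (suc (suc (suc D))) (suc (k + k))
    ≡⟨ cong (interval (suc (suc (suc D)))) (sym (+-suc k k)) ⟩
  interval (suc (suc (suc D))) (k + suc k) ∎))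
  where
  open ≡-Reasoning
  downStep : ∣ suc k + suc D - k ∣ ≡ suc (suc D)
  downStep = trans (cong (∣_- k ∣) (sym (+-suc k (suc D)))) (∣m+n-m∣≡n k (suc (suc D)))

spread-final : ∀ k b → final k (b ∷ spread (suc b) k) ≡ b + k
spread-final zero    b = sym (+-identityʳ b)
spread-final (suc k) b = trans (spread-final k (suc b)) (sym (+-suc b k))

-- Translate a perfect path of order K+1 to
-- [s+1, s+K+2) and surround it by [0, s] and [s+K+2, 2s+K+3): from s the
-- spread walk uses the lengths K+2, ..., K+2s+2 and ends at 2s+K+2, and one
-- jump of length K+1 enters the translated path at its start s+1+s.
mirror : ∀ {K s e} → PerfectPath (suc K) s e → PerfectPath (suc s + suc K + suc s) s (suc s + e)
mirror {K} {s} p@(perfect r vs ls refl) =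
  perfect (b ∷ spread (suc b) s ++ M) vertices′ lengths′ ends′
  where
  b : ℕ
  b = suc s + suc K
  M : List ℕ
  M = map (suc s +_) (s ∷ r)
  outer : List ℕ
  outer = b ∷ spread (suc b) s

  vertices′ : spread b (suc s) ++ M ↭ interval 0 (suc s + suc K + suc s)
  vertices′ = begin
    spread b (suc s) ++ M
      ↭⟨ ↭.++⁺ (spread-vertices b (suc s)) (translate-vertices (suc s) p) ⟩
    (interval 0 (suc s) ++ interval b (suc s)) ++ interval (suc s) (suc K)
      ≡⟨ List.++-assoc (interval 0 (suc s)) _ _ ⟩
    interval 0 (suc s) ++ interval b (suc s) ++ interval (suc s) (suc K)
      ↭⟨ ↭.++⁺ˡ (interval 0 (suc s)) (↭.++-comm (interval b (suc s)) _) ⟩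
    interval 0 (suc s) ++ interval (suc s) (suc K) ++ interval b (suc s)
      ≡⟨ sym (interval-++₃ (suc s) (suc K) (suc s)) ⟩
    interval 0 (suc s + suc K + suc s) ∎
    where open PermutationReasoning

  outer-steps : steps s outer ≡ interval (suc (suc K)) (suc (s + s))
  outer-steps = trans (cong (λ x → steps s (x ∷ spread (suc x) s)) (sym (+-suc s (suc K)))) (spread-steps s (suc K))

  reorder : ∀ s K → suc s + suc K + s ≡ suc s + s + suc K
  reorder = solve-∀
  size : ∀ s K → K + suc (suc (s + s)) ≡ s + suc K + suc s
  size = solve-∀

  jump : ∣ b + s - (suc s + s) ∣ ≡ suc K
  jump = trans (cong (∣_- suc s + s ∣) (reorder s K)) (∣m+n-m∣≡n (suc s + s) (suc K))

  lengths′ : steps s (outer ++ M) ↭ interval 1 (s + suc K + suc s)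
  lengths′ = begin
    steps s (outer ++ M)
      ≡⟨ steps-++ s outer M ⟩
    steps s outer ++ steps (final s outer) M
      ≡⟨ cong₂ _++_ outer-steps (cong (λ x → steps x M) (spread-final s b)) ⟩
    interval (suc (suc K)) (suc (s + s)) ++ (∣ b + s - (suc s + s) ∣ ∷ steps (suc s + s) (map (suc s +_) r))
      ≡⟨ cong (λ l → interval (suc (suc K)) (suc (s + s)) ++ l) (cong₂ _∷_ jump (steps-translate (suc s) s r)) ⟩
    interval (suc (suc K)) (suc (s + s)) ++ (suc K ∷ steps s r)
      ↭⟨ ↭.++-comm (interval (suc (suc K)) (suc (s + s))) _ ⟩
    suc K ∷ (steps s r ++ interval (suc (suc K)) (suc (s + s)))
      ↭⟨ ↭-sym (↭.shift (suc K) (steps s r) _) ⟩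
    steps s r ++ (suc K ∷ interval (suc (suc K)) (suc (s + s)))
      ↭⟨ lengths-++ K (suc (s + s)) ls ↭-refl ⟩
    interval 1 (K + suc (suc (s + s)))
      ≡⟨ cong (interval 1) (size s K) ⟩
    interval 1 (s + suc K + suc s) ∎
    where open PermutationReasoning

  ends′ : final s (outer ++ M) ≡ suc s + final s r
  ends′ = begin
    final s (outer ++ M)              ≡⟨ final-++ s outer M ⟩
    final (final s outer) M           ≡⟨ cong (λ x → final x M) (spread-final s b) ⟩
    final (suc s + s) (map (suc s +_) r) ≡⟨ final-translate (suc s) s r ⟩
    suc s + final s r                 ∎
    where open ≡-Reasoning

-- inward lo E n: the walk on n vertices that alternates between a top
-- segment read downwards and the bottom segment [lo, ...) read upwards,
--   lo+E+n-1, lo, lo+E+n-2, lo+1, ...,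
-- so that its steps E+n-1, ..., E+1 decrease by one.
mutual
  inward : ℕ → ℕ → ℕ → List ℕ
  inward lo E zero    = []
  inward lo E (suc n) = (lo + E + n) ∷ inwardBelow lo E n

  inwardBelow : ℕ → ℕ → ℕ → List ℕ
  inwardBelow lo E zero    = []
  inwardBelow lo E (suc n) = lo ∷ inward (suc lo) E n

mutual
  inwardBelow-steps : ∀ lo E n → steps (lo + E + n) (inwardBelow lo E n) ≡ descending (suc E) n
  inwardBelow-steps lo E zero    = refl
  inwardBelow-steps lo E (suc n) = cong₂ _∷_ down (inward-steps lo E n)
    where
    down : ∣ lo + E + suc n - lo ∣ ≡ suc E + n
    down = trans (cong (∣_- lo ∣) (trans (+-assoc lo E (suc n)) (cong (lo +_) (+-suc E n))))
                 (∣m+n-m∣≡n lo (suc E + n))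

  inward-steps : ∀ lo E n → steps lo (inward (suc lo) E n) ≡ descending (suc E) n
  inward-steps lo E zero    = refl
  inward-steps lo E (suc n) = cong₂ _∷_ up (inwardBelow-steps (suc lo) E n)
    where
    up : ∣ lo - suc lo + E + n ∣ ≡ suc E + n
    up = trans (cong (∣ lo -_∣) (trans (cong suc (+-assoc lo E n)) (sym (+-suc lo (E + n)))))
               (∣m-m+n∣≡n lo (suc E + n))

inward-vertices : ∀ lo E k t → t ≤ 1 →
                  inward lo E (k + k + t) ↭ interval lo k ++ interval (lo + E + k) (k + t)
inward-vertices lo E zero    zero    _         = ↭-refl
inward-vertices lo E zero    (suc .0) (s≤s z≤n) = ↭-refl
inward-vertices lo E (suc k) t       t≤1       = begin
  inward lo E (suc k + suc k + t)
    ≡⟨ cong (inward lo E) (count k t) ⟩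
  top ∷ lo ∷ inward (suc lo) E (k + k + t)
    ↭⟨ ↭-prep top (↭-prep lo (inward-vertices (suc lo) E k t t≤1)) ⟩
  top ∷ lo ∷ (A ++ interval (suc lo + E + k) (k + t))
    ≡⟨ cong (λ a → top ∷ lo ∷ (A ++ interval a (k + t))) (topStart lo E k) ⟩
  top ∷ lo ∷ (A ++ B)
    ↭⟨ ↭-swap top lo ↭-refl ⟩
  lo ∷ top ∷ (A ++ B)
    ↭⟨ ↭-prep lo (↭.∷↭∷ʳ top (A ++ B)) ⟩
  lo ∷ ((A ++ B) ++ [ top ])
    ≡⟨ cong (lo ∷_) (List.++-assoc A B [ top ]) ⟩
  lo ∷ (A ++ (B ++ [ top ]))
    ≡⟨ cong (λ x → lo ∷ (A ++ (B ++ [ x ]))) (topEnd lo E k t) ⟩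
  lo ∷ (A ++ (B ++ [ X + (k + t) ]))
    ≡⟨ cong (λ l → lo ∷ (A ++ l)) (sym (interval-∷ʳ X (k + t))) ⟩
  lo ∷ (A ++ interval X (suc k + t)) ∎
  where
  open PermutationReasoning
  top : ℕ
  top = lo + E + suc (k + k + t)
  X : ℕ
  X = lo + E + suc k
  A : List ℕ
  A = interval (suc lo) k
  B : List ℕ
  B = interval X (k + t)
  count : ∀ k t → suc k + suc k + t ≡ suc (suc (k + k + t))
  count = solve-∀
  topStart : ∀ lo E k → suc lo + E + k ≡ lo + E + suc k
  topStart = solve-∀
  topEnd : ∀ lo E k t → lo + E + suc (k + k + t) ≡ lo + E + suc k + (k + t)
  topEnd = solve-∀

final-inward-even : ∀ lo E k x → final x (inward lo E (suc k + suc k)) ≡ lo + k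
final-inward-even lo E zero    x = sym (+-identityʳ lo)
final-inward-even lo E (suc k) x = begin
  final lo (inward (suc lo) E (k + suc (suc k)))
    ≡⟨ cong (λ n → final lo (inward (suc lo) E n)) (+-suc k (suc k)) ⟩
  final lo (inward (suc lo) E (suc k + suc k))
    ≡⟨ final-inward-even (suc lo) E k lo ⟩
  suc lo + k
    ≡⟨ sym (+-suc lo k) ⟩
  lo + suc k ∎
  where open ≡-Reasoning

final-inward-odd : ∀ lo E k x → final x (inward lo E (suc (k + k))) ≡ lo + E + k
final-inward-odd lo E zero    x = refl
final-inward-odd lo E (suc k) x = begin
  final lo (inward (suc lo) E (k + suc k))
    ≡⟨ cong (λ n → final lo (inward (suc lo) E n)) (+-suc k k) ⟩
  final lo (inward (suc lo) E (suc (k + k)))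
    ≡⟨ final-inward-odd (suc lo) E k lo ⟩
  suc lo + E + k
    ≡⟨ shift lo E k ⟩
  lo + E + suc k ∎
  where
  open ≡-Reasoning
  shift : ∀ lo E k → suc lo + E + k ≡ lo + E + suc k
  shift = solve-∀

-- Translate a perfect path of order K+1 by w and continue from its end into
-- an inward walk around it, on 2w+t vertices (t ∈ {0,1}, w + t = e + 1):
-- the jump to the top has length K+1, after which the inward walk makes
-- the lengths K+2w+t-1, ..., K+2.
attachInward : ∀ {K s e} w t → t ≤ 1 → w + t ≡ suc e → (p : PerfectPath (suc K) s e) →
               PerfectPath (w + suc K + (w + t)) (w + s) (final (w + e) (inward 0 (suc K) (w + w + t)))
attachInward {K} {s} w t t≤1 w+t≡ p@(perfect r vs ls refl) =
  perfect (map (w +_) r ++ Z) vertices′ lengths′ ends′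
  where
  e : ℕ
  e = final s r
  n : ℕ
  n = w + e
  Z : List ℕ
  Z = inward 0 (suc K) (w + w + t)

  vertices′ : map (w +_) (s ∷ r) ++ Z ↭ interval 0 (w + suc K + (w + t))
  vertices′ = begin
    map (w +_) (s ∷ r) ++ Z
      ↭⟨ ↭.++⁺ (translate-vertices w p) (inward-vertices 0 (suc K) w t t≤1) ⟩
    interval w (suc K) ++ interval 0 w ++ interval (suc K + w) (w + t)
      ≡⟨ cong (λ a → interval w (suc K) ++ interval 0 w ++ interval a (w + t)) (+-comm (suc K) w) ⟩
    interval w (suc K) ++ interval 0 w ++ interval (w + suc K) (w + t)
      ↭⟨ ↭.shifts (interval w (suc K)) (interval 0 w) ⟩
    interval 0 w ++ interval w (suc K) ++ interval (w + suc K) (w + t)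
      ≡⟨ sym (interval-++₃ w (suc K) (w + t)) ⟩
    interval 0 (w + suc K + (w + t)) ∎
    where open PermutationReasoning

  Z≡ : Z ≡ (suc K + n) ∷ inwardBelow 0 (suc K) n
  Z≡ = cong (inward 0 (suc K)) (trans (+-assoc w w t) (trans (cong (w +_) w+t≡) (+-suc w e)))

  jump : ∣ n - suc K + n ∣ ≡ suc K
  jump = trans (cong (∣ n -_∣) (+-comm (suc K) n)) (∣m-m+n∣≡n n (suc K))

  order : ∀ w K e → K + suc (w + e) ≡ w + K + suc e
  order = solve-∀

  lengths′ : steps (w + s) (map (w +_) r ++ Z) ↭ interval 1 (pred (w + suc K + (w + t)))
  lengths′ = begin
    steps (w + s) (map (w +_) r ++ Z)
      ≡⟨ steps-++ (w + s) (map (w +_) r) Z ⟩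
    steps (w + s) (map (w +_) r) ++ steps (final (w + s) (map (w +_) r)) Z
      ≡⟨ cong₂ _++_ (steps-translate w s r) (cong₂ steps (final-translate w s r) Z≡) ⟩
    steps s r ++ (∣ n - suc K + n ∣ ∷ steps (suc K + n) (inwardBelow 0 (suc K) n))
      ≡⟨ cong (λ l → steps s r ++ l) (cong₂ _∷_ jump (inwardBelow-steps 0 (suc K) n)) ⟩
    steps s r ++ (suc K ∷ descending (suc (suc K)) n)
      ↭⟨ lengths-++ K n ls (descending↭interval (suc (suc K)) n) ⟩
    interval 1 (K + suc n)
      ≡⟨ cong (interval 1) (order w K e) ⟩
    interval 1 (w + K + suc e)
      ≡⟨ cong (λ x → interval 1 (pred (x + suc e))) (sym (+-suc w K)) ⟩
    interval 1 (pred (w + suc K + suc e))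
      ≡⟨ cong (λ x → interval 1 (pred (w + suc K + x))) (sym w+t≡) ⟩
    interval 1 (pred (w + suc K + (w + t))) ∎
    where open PermutationReasoning

  ends′ : final (w + s) (map (w +_) r ++ Z) ≡ final n Z
  ends′ = trans (final-++ (w + s) (map (w +_) r) Z) (cong (λ x → final x Z) (final-translate w s r))

zigzagEven : ∀ {K s e} → PerfectPath (suc K) s e → PerfectPath (suc e + suc K + suc e) (suc e + s) e
zigzagEven {K} {s} {e} p =
  castPath (cong (suc e + suc K +_) (+-identityʳ (suc e))) refl finishes
           (attachInward (suc e) 0 z≤n (+-identityʳ (suc e)) p)
  where
  finishes : final (suc e + e) (inward 0 (suc K) (suc e + suc e + 0)) ≡ e
  finishes = trans (cong (λ n → final (suc e + e) (inward 0 (suc K) n)) (+-identityʳ (suc e + suc e)))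
               (final-inward-even 0 (suc K) e (suc e + e))

zigzagOdd : ∀ {K s e} → PerfectPath (suc K) s e → PerfectPath (e + suc K + suc e) (e + s) (e + suc K)
zigzagOdd {K} {s} {e} p =
  castPath (cong (e + suc K +_) (+-comm e 1)) refl finishes
           (attachInward e 1 (s≤s z≤n) (+-comm e 1) p)
  where
  finishes : final (e + e) (inward 0 (suc K) (e + e + 1)) ≡ e + suc K
  finishes = begin
    final (e + e) (inward 0 (suc K) (e + e + 1)) ≡⟨ cong (λ n → final (e + e) (inward 0 (suc K) n)) (+-comm (e + e) 1) ⟩
    final (e + e) (inward 0 (suc K) (suc (e + e))) ≡⟨ final-inward-odd 0 (suc K) e (e + e) ⟩
    suc K + e                                     ≡⟨ +-comm (suc K) e ⟩
    e + suc K                                     ∎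
    where open ≡-Reasoning

EvenPath : ℕ → ℕ → Set
EvenPath h s = PerfectPath (h + h) s (s + h)

OddPath : ℕ → ℕ → Set
OddPath h s = PerfectPath (suc (h + h)) s (s + h)

mirrorEven : ∀ {h s} → EvenPath (suc h) s → EvenPath (suc h + suc s) s
mirrorEven {h} {s} p = castPath (size h s) refl (ends h s) (mirror p)
  where
  size : ∀ h s → suc s + suc (h + suc h) + suc s ≡ suc h + suc s + (suc h + suc s)
  size = solve-∀
  ends : ∀ h s → suc s + (s + suc h) ≡ s + (suc h + suc s)
  ends = solve-∀

mirrorOdd : ∀ {h s} → OddPath h s → OddPath (h + suc s) s
mirrorOdd {h} {s} p = castPath (size h s) refl (ends h s) (mirror p)
  where
  size : ∀ h s → suc s + suc (h + h) + suc s ≡ suc (h + suc s + (h + suc s))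
  size = solve-∀
  ends : ∀ h s → suc s + (s + h) ≡ s + (h + suc s)
  ends = solve-∀

centreEven : ∀ {s} → OddPath s 0 → EvenPath (suc (s + s)) s
centreEven {s} p = castPath (size s) (+-identityʳ s) refl (zigzagOdd p)
  where
  size : ∀ s → s + suc (s + s) + suc s ≡ suc (s + s) + suc (s + s)
  size = solve-∀

centreOdd : ∀ {s} → EvenPath (suc s) 0 → OddPath (suc s + suc s) (suc s)
centreOdd {s} p = castPath (size s) (+-identityʳ (suc s)) refl (zigzagOdd p)
  where
  size : ∀ s → suc s + suc (s + suc s) + suc (suc s) ≡ suc (suc s + suc s + (suc s + suc s))
  size = solve-∀

flipZigzag : ∀ {K x e} x′ y → PerfectPath (suc K) x e → x + x′ ≡ K → e + y ≡ K →
             PerfectPath (suc y + suc K + suc y) (suc (y + x)) (suc K + suc y)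
flipZigzag {K} {x} x′ y p x+x′≡K e+y≡K =
  reflect (suc (y + x)) (suc K + suc y) (zigzagEven (reflect x′ y p x+x′≡K e+y≡K))
          (trans (starts y x x′) (cong (λ k → y + suc k + suc y) x+x′≡K))
          (sym (+-assoc y (suc K) (suc y)))
  where
  starts : ∀ y x x′ → suc y + x′ + suc (y + x) ≡ y + suc (x + x′) + suc y
  starts = solve-∀

CentredPaths : ℕ → Set
CentredPaths h = (∀ s → s < h → EvenPath h s) × (∀ s → s ≤ h → OddPath h s)

-- Even order 2h, with h = s + 1 + y: if s < y, mirror the path from s of
-- half-order h - s - 1; if s = y, apply the odd zigzag to the path of order
-- 2s+1 from 0; if s = y + 1 + x, apply flipZigzag to the path from x of
-- half-order y + x + 1.  All recursive calls have smaller half-order.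
evenCentred : ∀ h → WfRec _<_ CentredPaths h → ∀ s → s < h → EvenPath h s
evenCentred h rec s s<h with m≤n⇒∃[o]m+o≡n s<h
... | y , refl with <-cmp s y
...   | tri< s<y _ _ with m≤n⇒∃[o]m+o≡n s<y
...     | t , refl = subst (λ h → EvenPath h s) (+-comm (suc (s + t)) (suc s))
                       (mirrorEven (proj₁ (rec (s≤s (m≤n+m _ s))) s (s≤s (m≤m+n s t))))
evenCentred h rec s s<h | y , refl | tri≈ _ refl _ =
  centreEven (proj₂ (rec (s≤s (m≤m+n s s))) 0 z≤n)
evenCentred h rec s s<h | y , refl | tri> _ _ y<s with m≤n⇒∃[o]m+o≡n y<s
... | x , refl = castPath (size y x) refl (ends y x)
                   (flipZigzag (y + suc (y + x)) y (proj₁ (rec (s≤s (m≤m+n _ y))) x (s≤s (m≤n+m x y)))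
                     (reflected y x) (reflectedEnd y x))
  where
  reflected : ∀ y x → x + (y + suc (y + x)) ≡ y + x + suc (y + x)
  reflected = solve-∀
  reflectedEnd : ∀ y x → x + suc (y + x) + y ≡ y + x + suc (y + x)
  reflectedEnd = solve-∀
  size : ∀ y x → suc y + suc (y + x + suc (y + x)) + suc y ≡ suc (suc (y + x) + y) + suc (suc (y + x) + y)
  size = solve-∀
  ends : ∀ y x → suc (y + x + suc (y + x)) + suc y ≡ suc (y + x) + suc (suc (y + x) + y)
  ends = solve-∀

oddMiddle : ∀ s → WfRec _<_ CentredPaths (s + s) → OddPath (s + s) s
oddMiddle zero    rec = trivialPath
oddMiddle (suc s) rec = centreOdd (proj₁ (rec (s≤s (m≤n+m (suc s) s))) 0 (s≤s z≤n))

oddCentred : ∀ h → WfRec _<_ CentredPaths h → ∀ s → s ≤ h → OddPath h s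
oddCentred h rec s s≤h with m≤n⇒∃[o]m+o≡n s≤h
... | y , refl with <-cmp s y
...   | tri< s<y _ _ with m≤n⇒∃[o]m+o≡n s<y
...     | t , refl = subst (λ h → OddPath h s) (reorder s t)
                       (mirrorOdd (proj₂ (rec (+-monoʳ-< s (s≤s (m≤n+m t s)))) s (m≤m+n s t)))
  where
  reorder : ∀ s t → s + t + suc s ≡ s + suc (s + t)
  reorder = solve-∀
oddCentred h rec s s≤h | y , refl | tri≈ _ refl _ = oddMiddle s rec
oddCentred h rec s s≤h | y , refl | tri> _ _ y<s with m≤n⇒∃[o]m+o≡n y<s
... | x , refl = castPath (size y x) refl (ends y x)
                   (flipZigzag (y + (y + x)) y (proj₂ (rec (s≤s (m≤m+n (y + x) y))) x (m≤n+m x y))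
                     (reflected y x) (reflectedEnd y x))
  where
  reflected : ∀ y x → x + (y + (y + x)) ≡ y + x + (y + x)
  reflected = solve-∀
  reflectedEnd : ∀ y x → x + (y + x) + y ≡ y + x + (y + x)
  reflectedEnd = solve-∀
  size : ∀ y x → suc y + suc (y + x + (y + x)) + suc y ≡ suc (suc (y + x) + y + (suc (y + x) + y))
  size = solve-∀
  ends : ∀ y x → suc (y + x + (y + x)) + suc y ≡ suc (y + x) + (suc (y + x) + y)
  ends = solve-∀

centredPaths : ∀ h → CentredPaths h
centredPaths = <-rec CentredPaths λ h rec → evenCentred h rec , oddCentred h rec

halve : ∀ n → Σ[ h ∈ ℕ ] (n ≡ h + h ⊎ n ≡ suc (h + h))
halve zero    = 0 , inj₁ refl
halve (suc n) with halve n
... | h , inj₁ refl = h , inj₂ refl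
... | h , inj₂ refl = suc h , inj₁ (cong suc (sym (+-suc h h)))

double-<⇒< : ∀ {s h} → s + s < h + h → s < h
double-<⇒< ss<hh = ≰⇒> λ h≤s → <⇒≱ ss<hh (+-mono-≤ h≤s h≤s)

double-≤⇒≤ : ∀ {s h} → s + s ≤ h + h → s ≤ h
double-≤⇒≤ ss≤hh = ≮⇒≥ λ h<s → <⇒≱ (+-mono-< h<s h<s) ss≤hh

perfectFromLowerHalf : ∀ n s → s + s < n → Σ[ e ∈ ℕ ] PerfectPath n s e
perfectFromLowerHalf n s ss<n with halve n
... | h , inj₁ refl = s + h , proj₁ (centredPaths h) s (double-<⇒< ss<n)
... | h , inj₂ refl = s + h , proj₂ (centredPaths h) s (double-≤⇒≤ (≤-pred ss<n))

mirror-lowerHalf : ∀ z p → z + p < p + p → z + z < suc (z + p)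
mirror-lowerHalf z p c<pp = s≤s (≮⇒≥ λ c<zz → <-irrefl (regroup z p) (+-mono-< c<zz c<pp))
  where
  regroup : ∀ z p → z + p + (z + p) ≡ z + z + (p + p)
  regroup = solve-∀

-- Every vertex starts a perfect path: a vertex in the upper half is the
-- mirror image of one in the lower half, so reflect that vertex's path.
perfectFrom : ∀ n p → p < n → Σ[ e ∈ ℕ ] PerfectPath n p e
perfectFrom (suc c) p (s≤s p≤c) with p + p <? suc c
... | yes pp<n = perfectFromLowerHalf (suc c) p pp<n
... | no  pp≮n with m≤n⇒∃[o]m+o≡n p≤c
...   | z , refl with perfectFromLowerHalf (suc (p + z)) z lower
  where
  upper : z + p < p + p
  upper = subst (_< p + p) (+-comm p z) (≤-pred (≰⇒> pp≮n))
  lower : z + z < suc (p + z)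
  lower = subst (λ c → z + z < suc c) (+-comm z p) (mirror-lowerHalf z p upper)
...     | e , q with m≤n⇒∃[o]m+o≡n (≤-pred (final<order q))
...       | e′ , e+e′≡c = e′ , reflect p e′ q (+-comm z p) e+e′≡c

record GapRealization (L : List ℕ) (k : ℕ) : Set where
  constructor realization
  field
    top      : ℕ
    walk     : List ℕ
    gap      : ℕ
    covers   : (0 ∷ walk) ↭ interval 0 (suc top)
    realizes : steps 0 walk ↭ L
    ends     : final 0 walk + gap ≡ top
    gap≤     : gap ≤ k

emptyRealization : GapRealization [] 0
emptyRealization = realization 0 [] 0 ↭-refl ↭-refl refl z≤n

weaken : ∀ {L k k′} → k ≤ k′ → GapRealization L k → GapRealization L k′
weaken k≤k′ (realization N r g cov rel ends g≤k) = realization N r g cov rel ends (≤-trans g≤k k≤k′)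

permute : ∀ {L L′ k} → L ↭ L′ → GapRealization L k → GapRealization L′ k
permute L↭L′ (realization N r g cov rel ends g≤k) = realization N r g cov (↭-trans rel L↭L′) ends g≤k

-- Appending the block 1, ..., k+1.  If the walk ends at top - g, continue
-- with a jump of length k+1 to top + 1 + p, where g + p = k, followed by a
-- perfect path of order k+1 from p translated to [top+1, top+k+2).  Its end
-- again lies at most k below the new top.
appendBlock : ∀ {L k} → GapRealization L k → GapRealization (L ++ interval 1 (suc k)) k
appendBlock {L} (realization N r g cov rel refl g≤k) with m≤n⇒∃[o]m+o≡n g≤k
... | p , refl with perfectFrom (suc (g + p)) p (s≤s (m≤n+m p g))
... | e , Q@(perfect r′ vs′ ls′ refl) with m≤n⇒∃[o]m+o≡n (≤-pred (final<order Q))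
... | g′ , e+g′≡k = realization (N + suc k) (r ++ M) g′ covers′ realizes′ ends′ (subst (g′ ≤_) e+g′≡k (m≤n+m g′ e))
  where
  k : ℕ
  k = g + p
  l : ℕ
  l = final 0 r
  M : List ℕ
  M = map (suc N +_) (p ∷ r′)

  covers′ : (0 ∷ r ++ M) ↭ interval 0 (suc (N + suc k))
  covers′ = ↭-trans (↭.++⁺ cov (translate-vertices (suc N) Q)) (↭-reflexive (sym (interval-++ 0 (suc N) (suc k))))

  landing : ∀ l g p → suc (l + g + p) ≡ l + suc (g + p)
  landing = solve-∀

  jump : ∣ l - suc N + p ∣ ≡ suc k
  jump = trans (cong (∣ l -_∣) (landing l g p)) (∣m-m+n∣≡n l (suc k))

  realizes′ : steps 0 (r ++ M) ↭ L ++ interval 1 (suc k)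
  realizes′ = begin
    steps 0 (r ++ M)                    ≡⟨ steps-++ 0 r M ⟩
    steps 0 r ++ steps l M              ≡⟨ cong (steps 0 r ++_) (cong₂ _∷_ jump (steps-translate (suc N) p r′)) ⟩
    steps 0 r ++ (suc k ∷ steps p r′)   ↭⟨ ↭.++⁺ rel (↭-prep (suc k) ls′) ⟩
    L ++ (suc k ∷ interval 1 k)         ↭⟨ ↭.++⁺ˡ L (↭.∷↭∷ʳ (suc k) (interval 1 k)) ⟩
    L ++ (interval 1 k ++ [ suc k ])    ≡⟨ cong (L ++_) (sym (interval-∷ʳ 1 k)) ⟩
    L ++ interval 1 (suc k)             ∎
    where open PermutationReasoning

  regroup : ∀ N e g′ → suc N + e + g′ ≡ N + suc (e + g′)
  regroup = solve-∀

  ends′ : final 0 (r ++ M) + g′ ≡ N + suc k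
  ends′ = begin
    final 0 (r ++ M) + g′             ≡⟨ cong (_+ g′) (final-++ 0 r M) ⟩
    final l M + g′                    ≡⟨ cong (_+ g′) (final-translate (suc N) p r′) ⟩
    suc N + e + g′                    ≡⟨ regroup N e g′ ⟩
    N + suc (e + g′)                  ≡⟨ cong (λ x → N + suc x) e+g′≡k ⟩
    N + suc k                         ∎
    where open ≡-Reasoning

blocks : ℕ → ℕ → List ℕ
blocks c b = concat (replicate c (interval 1 b))

appendBlocks : ∀ {L k} c → GapRealization L k → GapRealization (L ++ blocks c (suc k)) k
appendBlocks {L} zero    R = permute (↭-reflexive (sym (List.++-identityʳ L))) R
appendBlocks {L} {k} (suc c) R =
  permute (↭-reflexive (List.++-assoc L (interval 1 (suc k)) (blocks c (suc k)))) (appendBlocks c (appendBlock R))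

standard : ∀ {L k} → GapRealization L k → Σ[ xs ∈ List ℕ ] StandardLinearRealization L xs
standard {L} (realization N r g cov rel ends g≤k) = 0 ∷ r , (covers′ , realizes′) , refl
  where
  length≡top : length L ≡ N
  length≡top = begin
    length L                          ≡⟨ sym (↭.↭-length rel) ⟩
    length (steps 0 r)                ≡⟨ length-steps 0 r ⟩
    pred (length (0 ∷ r))             ≡⟨ cong pred (↭.↭-length cov) ⟩
    pred (length (interval 0 (suc N))) ≡⟨ cong pred (length-interval 0 (suc N)) ⟩
    N                                 ∎
    where open ≡-Reasoning
  covers′ : (0 ∷ r) ↭ upTo (suc (length L))
  covers′ = subst (λ n → (0 ∷ r) ↭ n) (sym (trans (upTo≡interval (suc (length L))) (cong (λ n → interval 0 (suc n)) length≡top))) cov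
  realizes′ : diffs (0 ∷ r) ↭ L
  realizes′ = subst (_↭ L) (sym (diffs≡steps 0 r)) rel

replicate-+ : ∀ m n (x : ℕ) → replicate (m + n) x ≡ replicate m x ++ replicate n x
replicate-+ zero    n x = refl
replicate-+ (suc m) n x = cong (x ∷_) (replicate-+ m n x)

interchange : ∀ (A B C D : List ℕ) → (A ++ B) ++ (C ++ D) ↭ (A ++ C) ++ (B ++ D)
interchange A B C D = begin
  (A ++ B) ++ (C ++ D) ≡⟨ List.++-assoc A B (C ++ D) ⟩
  A ++ (B ++ (C ++ D)) ↭⟨ ↭.++⁺ˡ A (↭.shifts B C) ⟩
  A ++ (C ++ (B ++ D)) ≡⟨ sym (List.++-assoc A C (B ++ D)) ⟩
  (A ++ C) ++ (B ++ D) ∎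
  where open PermutationReasoning

tabulate-∷ʳ : ∀ {A : Set} {n} (f : Fin (suc n) → A) → tabulate f ≡ tabulate (f ∘ inject₁) ∷ʳ f (fromℕ n)
tabulate-∷ʳ {n = zero}  f = refl
tabulate-∷ʳ {n = suc n} f = cong (f Fin.zero ∷_) (tabulate-∷ʳ (f ∘ Fin.suc))

multisetList-∷ʳ : ∀ m (a : Fin (suc m) → ℕ) →
                  multisetList (suc m) a ≡ multisetList m (a ∘ inject₁) ++ replicate (a (fromℕ m)) (suc m)
multisetList-∷ʳ m a = begin
  concat (map copies (allFin (suc m)))                 ≡⟨ cong concat (List.map-tabulate (λ i → i) copies) ⟩
  concat (tabulate copies)                             ≡⟨ cong concat (tabulate-∷ʳ copies) ⟩
  concat (tabulate (copies ∘ inject₁) ∷ʳ copies (fromℕ m)) ≡⟨ sym (List.concat-++ (tabulate (copies ∘ inject₁)) _) ⟩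
  concat (tabulate (copies ∘ inject₁)) ++ concat [ copies (fromℕ m) ]
    ≡⟨ cong₂ _++_ (cong concat earlier) (trans (List.++-identityʳ _) (cong (replicate (a (fromℕ m)) ∘ suc) (Fin.toℕ-fromℕ m))) ⟩
  multisetList m (a ∘ inject₁) ++ replicate (a (fromℕ m)) (suc m) ∎
  where
  open ≡-Reasoning
  copies : Fin (suc m) → List ℕ
  copies i = replicate (a i) (suc (toℕ i))
  earlier : tabulate (copies ∘ inject₁) ≡ map (λ i → replicate (a (inject₁ i)) (suc (toℕ i))) (allFin m)
  earlier = trans (List.tabulate-cong (λ i → cong (replicate (a (inject₁ i)) ∘ suc) (Fin.toℕ-inject₁ i))) (sym (List.map-tabulate (λ i → i) _))

blocks-empty : ∀ c → blocks c 0 ≡ []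
blocks-empty zero    = refl
blocks-empty (suc c) = blocks-empty c

blocks-∷ʳ : ∀ c k → blocks c (suc k) ↭ blocks c k ++ replicate c (suc k)
blocks-∷ʳ zero    k = ↭-refl
blocks-∷ʳ (suc c) k = begin
  interval 1 (suc k) ++ blocks c (suc k)
    ↭⟨ ↭.++⁺ (↭-reflexive (interval-∷ʳ 1 k)) (blocks-∷ʳ c k) ⟩
  (interval 1 k ++ [ suc k ]) ++ (blocks c k ++ replicate c (suc k))
    ↭⟨ interchange (interval 1 k) [ suc k ] (blocks c k) _ ⟩
  (interval 1 k ++ blocks c k) ++ (suc k ∷ replicate c (suc k)) ∎
  where open PermutationReasoning

multisetList-+ : ∀ m (b : Fin m → ℕ) c → multisetList m (λ i → b i + c) ↭ multisetList m b ++ blocks c m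
multisetList-+ zero    b c = ↭-reflexive (sym (blocks-empty c))
multisetList-+ (suc m) b c = begin
  multisetList (suc m) (λ i → b i + c)
    ≡⟨ multisetList-∷ʳ m (λ i → b i + c) ⟩
  multisetList m (λ i → b (inject₁ i) + c) ++ replicate (b (fromℕ m) + c) (suc m)
    ↭⟨ ↭.++⁺ (multisetList-+ m (b ∘ inject₁) c) (↭-reflexive (replicate-+ (b (fromℕ m)) c (suc m))) ⟩
  (multisetList m (b ∘ inject₁) ++ blocks c m) ++ (replicate (b (fromℕ m)) (suc m) ++ replicate c (suc m))
    ↭⟨ interchange (multisetList m (b ∘ inject₁)) (blocks c m) _ _ ⟩
  (multisetList m (b ∘ inject₁) ++ replicate (b (fromℕ m)) (suc m)) ++ (blocks c m ++ replicate c (suc m))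
    ↭⟨ ↭.++⁺ (↭-reflexive (sym (multisetList-∷ʳ m b))) (↭-sym (blocks-∷ʳ c m)) ⟩
  multisetList (suc m) b ++ blocks c (suc m) ∎
  where open PermutationReasoning

Antitone : ∀ {m} → (Fin m → ℕ) → Set
Antitone a = ∀ i j → i ≤ᶠ j → a j ≤ a i

-- Main induction on m: with c the last multiplicity, the multiset for m+1
-- values is c blocks 1, ..., m+1 added to the multiset for the antitone
-- multiplicities aᵢ - c of the first m values, which by induction has a gap
-- realization with gap ≤ m and so accepts these blocks.
realizeMultiset : ∀ m (a : Fin m → ℕ) → Antitone a → GapRealization (multisetList m a) m
realizeMultiset zero    a antitone = emptyRealization
realizeMultiset (suc m) a antitone =
  permute split (weaken (n≤1+n m) (appendBlocks c (realizeMultiset m reduced reduced-antitone)))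
  where
  c : ℕ
  c = a (fromℕ m)
  c≤ : ∀ i → c ≤ a (inject₁ i)
  c≤ i = antitone (inject₁ i) (fromℕ m) (Fin.≤fromℕ (inject₁ i))
  reduced : Fin m → ℕ
  reduced i = a (inject₁ i) ∸ c
  reduced-antitone : Antitone reduced
  reduced-antitone i j i≤j =
    ∸-monoˡ-≤ c (antitone (inject₁ i) (inject₁ j) (subst₂ _≤_ (sym (Fin.toℕ-inject₁ i)) (sym (Fin.toℕ-inject₁ j)) i≤j))
  restored : multisetList m (λ i → reduced i + c) ≡ multisetList m (a ∘ inject₁)
  restored = cong concat (List.map-cong (λ i → cong (λ n → replicate n (suc (toℕ i))) (m∸n+n≡m (c≤ i))) (allFin m))
  split : multisetList m reduced ++ blocks c (suc m) ↭ multisetList (suc m) a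
  split = begin
    multisetList m reduced ++ blocks c (suc m)
      ↭⟨ ↭.++⁺ˡ (multisetList m reduced) (blocks-∷ʳ c m) ⟩
    multisetList m reduced ++ (blocks c m ++ replicate c (suc m))
      ≡⟨ sym (List.++-assoc (multisetList m reduced) (blocks c m) _) ⟩
    (multisetList m reduced ++ blocks c m) ++ replicate c (suc m)
      ↭⟨ ↭.++⁺ʳ _ (↭-sym (multisetList-+ m reduced c)) ⟩
    multisetList m (λ i → reduced i + c) ++ replicate c (suc m)
      ≡⟨ cong (_++ replicate c (suc m)) restored ⟩
    multisetList m (a ∘ inject₁) ++ replicate c (suc m)
      ≡⟨ sym (multisetList-∷ʳ m a) ⟩
    multisetList (suc m) a ∎
    where open PermutationReasoning

theorem6p6 : (m : ℕ) → 1 ≤ m → (a : Fin m → ℕ) →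
    (∀ (i j : Fin m) → i ≤ᶠ j → a j ≤ a i) →
    (∀ (i : Fin m) → 0 < a i) →
    Σ (List ℕ) (λ xs → StandardLinearRealization (multisetList m a) xs)
theorem6p6 m _ a antitone _ = standard (realizeMultiset m a antitone)
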